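{- The following two statements are equivalent. (A) (Union-closed sets conjecture) For every finite union-closed set $\mathcal X$ of finite sets with $\mathcal X\neq\{\emptyset\}$, there is an element $x\in\bigcup_{X\in\mathcal X}X$ that lies in at least half of the members of $\mathcal X$. (B) For every finite bipartite graph $G$ with at least one edge and with bipartition classes $U,W$, each of $U$ and $W$ contains a vertex belonging to at most half of the maximal stable sets of $G$.
   Context: A set $\mathcal X$ of sets is union-closed if $X,Y\in\mathcal X$ implies $X\cup Y\in\mathcal X$. A set of vertices of a graph is stable if no two of its vertices are adjacent; a stable set is maximal if it is maximal under inclusion. -}

module Defs where

open import Data.Nat using (ℕ; _*_; _≤_)
open import Data.Fin using (Fin)
open import Data.Fin.Subset using (Subset; _∈_; _⊆_; _∪_; ⊥)
open import Data.Fin.Subset.Properties using (_∈?_)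
open import Data.List using (List; length; filter)
open import Data.List.Relation.Unary.Unique.Propositional using (Unique)
import Data.List.Membership.Propositional as LMem
open import Data.Product using (Σ; ∃; _×_; _,_; proj₁; proj₂)
open import Data.Bool using (Bool; true)
open import Relation.Binary.PropositionalEquality using (_≡_)
open import Relation.Nullary using (¬_)
open import Function.Bundles using (_⇔_)

-- (A) Union-closed families.
-- A finite family of finite sets is modelled (wlog) as a duplicate-free
-- list 𝒳 of subsets of a finite ground set Fin n.

_∈𝓕_ : ∀ {n} → Subset n → List (Subset n) → Set
X ∈𝓕 𝒳 = LMem._∈_ X 𝒳

UnionClosed : ∀ {n} → List (Subset n) → Set
UnionClosed 𝒳 = ∀ X Y → X ∈𝓕 𝒳 → Y ∈𝓕 𝒳 → (X ∪ Y) ∈𝓕 𝒳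

IsSingletonEmpty : ∀ {n} → List (Subset n) → Set
IsSingletonEmpty 𝒳 = ∀ X → (X ∈𝓕 𝒳 ⇔ X ≡ ⊥)

countContaining : ∀ {n} → Fin n → List (Subset n) → ℕ
countContaining x 𝒳 = length (filter (x ∈?_) 𝒳)

UnionClosedConjecture : Set
UnionClosedConjecture =
  ∀ (n : ℕ) (𝒳 : List (Subset n)) →
  Unique 𝒳 →
  UnionClosed 𝒳 →
  (∃ λ X → X ∈𝓕 𝒳) →
  ¬ IsSingletonEmpty 𝒳 →
  ∃ λ (x : Fin n) →
    (∃ λ X → X ∈𝓕 𝒳 × x ∈ X) ×
    length 𝒳 ≤ 2 * countContaining x 𝒳

-- A finite bipartite graph with bipartition classes U = Fin p, W = Fin q
-- is given by its adjacency E : Fin p → Fin q → Bool (edges only between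
-- the classes).

VSet : ℕ → ℕ → Set
VSet p q = Subset p × Subset q

_⊆V_ : ∀ {p q} → VSet p q → VSet p q → Set
S ⊆V T = (proj₁ S ⊆ proj₁ T) × (proj₂ S ⊆ proj₂ T)

Stable : ∀ {p q} → (Fin p → Fin q → Bool) → VSet p q → Set
Stable E S = ∀ u w → u ∈ proj₁ S → w ∈ proj₂ S → ¬ (E u w ≡ true)

MaximalStable : ∀ {p q} → (Fin p → Fin q → Bool) → VSet p q → Set
MaximalStable E S = Stable E S × (∀ T → Stable E T → S ⊆V T → T ≡ S)

HasEdge : ∀ {p q} → (Fin p → Fin q → Bool) → Set
HasEdge E = ∃ λ u → ∃ λ w → E u w ≡ true

countU : ∀ {p q} → Fin p → List (VSet p q) → ℕ
countU u L = length (filter (λ S → u ∈? proj₁ S) L)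

countW : ∀ {p q} → Fin q → List (VSet p q) → ℕ
countW w L = length (filter (λ S → w ∈? proj₂ S) L)

-- the finite set of maximal stable sets of G is given by any
-- duplicate-free list enumerating exactly them
BipartiteStatement : Set
BipartiteStatement =
  ∀ (p q : ℕ) (E : Fin p → Fin q → Bool) →
  HasEdge E →
  ∀ (L : List (VSet p q)) →
  Unique L →
  (∀ S → (LMem._∈_ S L ⇔ MaximalStable E S)) →
  (∃ λ (u : Fin p) → 2 * countU u L ≤ length L) ×
  (∃ λ (w : Fin q) → 2 * countW w L ≤ length L)

-- In a bipartite graph with classes U and W, a set A ⊆ U has the non-neighbours
-- f A ⊆ W, and dually g B ⊆ U for B ⊆ W; the maximal stable sets are exactly the
-- pairs (A , f A) with A closed (g (f A) = A).  Closed sets are stable under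
-- intersection, so their complements in U form a union-closed family, in
-- bijection with the maximal stable sets; a vertex lying in at least half of the
-- complements lies in at most half of the maximal stable sets (for W, transpose
-- the graph).  Conversely, a union-closed family 𝒳 containing ∅ is recovered in
-- this way from its incidence graph (U the ground set, W = 𝒳, u ~ X iff u ∈ X),
-- whose maximal stable sets are (U ∖ X , {Y ∈ 𝒳 ∣ Y ⊆ X}) for X ∈ 𝒳.  Adding ∅
-- to 𝒳 is harmless: it keeps 𝒳 union-closed and only makes the counting
-- inequality harder.

module Submission where

open import Defs
open import Function.Bundles using (_⇔_; mk⇔; Equivalence)
open import Function.Construct.Identity using (⇔-id)
open import Function using (_∘_; flip; id)
open import Data.Nat using (ℕ; suc; _+_; _*_; _≤_; _<_)
open import Data.Nat.Properties
open import Data.Bool using (Bool; true) renaming (_≟_ to _≟ᵇ_)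
open import Data.Empty using (⊥-elim)
open import Data.Fin using (Fin)
open import Data.Fin.Properties using (all?)
open import Data.Fin.Subset using (Subset; _∈_; _⊆_; _∪_; _∩_; ⊥; ∁; ⁅_⁆; ⋃; Nonempty)
open import Data.Fin.Subset.Properties
open import Data.Vec using (tabulate)
open import Data.Vec.Properties using (lookup⇒[]=; []=⇒lookup; lookup∘tabulate; ≡-dec)
open import Data.List using (List; []; _∷_; length; filter; map; lookup)
open import Data.List.Properties using (length-map; map-∘; map-cong-local; map-id)
open import Data.List.Membership.Propositional using (find) renaming (_∈_ to _∈ₗ_)
open import Data.List.Membership.Propositional.Properties
  using (∈-map⁺; ∈-map⁻; ∈-filter⁺; ∈-filter⁻; ∈-lookup; ∈-length)
open import Data.List.Relation.Unary.Any using (here; there; index; any?)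
open import Data.List.Relation.Unary.Any.Properties using (lookup-index)
import Data.List.Relation.Unary.All as All
open import Data.List.Relation.Unary.All.Properties using (¬Any⇒All¬)
open import Data.List.Relation.Unary.AllPairs using (_∷_)
open import Data.List.Relation.Unary.Unique.Propositional using (Unique)
import Data.List.Relation.Unary.Unique.Propositional.Properties as Unique
open import Data.Product using (∃; _×_; _,_; proj₁; proj₂; swap)
open import Data.Sum using (inj₁; inj₂)
open import Relation.Binary.PropositionalEquality
open import Relation.Nullary using (¬_; Dec; yes; no; does; contradiction)
open import Relation.Nullary.Decidable using (dec-true; ¬?; _→-dec_)
open import Relation.Unary using (Decidable)
import Algebra.Lattice.Properties.BooleanAlgebra as BooleanAlgebra

private
  variable
    n p q : ℕ
    A B C X : Subset n
    𝒳 𝒰 : List (Subset n)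

does≡true⇒ : ∀ {P : Set} (P? : Dec P) → does P? ≡ true → P
does≡true⇒ (yes p) _ = p
does≡true⇒ (no _) ()

subset : {P : Fin n → Set} → Decidable P → Subset n
subset P? = tabulate (does ∘ P?)

module _ {P : Fin n → Set} (P? : Decidable P) {x : Fin n} where

  ∈-subset⁺ : P x → x ∈ subset P?
  ∈-subset⁺ px = lookup⇒[]= x (subset P?) (trans (lookup∘tabulate _ x) (dec-true (P? x) px))

  ∈-subset⁻ : x ∈ subset P? → P x
  ∈-subset⁻ x∈ = does≡true⇒ (P? x) (trans (sym (lookup∘tabulate _ x)) ([]=⇒lookup x∈))

∁-involutive : ∀ (A : Subset n) → ∁ (∁ A) ≡ A
∁-involutive {n} = BooleanAlgebra.¬-involutive (∪-∩-booleanAlgebra n)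

∁-∩ : ∀ (A B : Subset n) → ∁ (A ∩ B) ≡ ∁ A ∪ ∁ B
∁-∩ {n} = BooleanAlgebra.deMorgan₁ (∪-∩-booleanAlgebra n)

∁-injective : ∁ A ≡ ∁ B → A ≡ B
∁-injective {A = A} {B} ∁A≡∁B = begin
  A        ≡⟨ ∁-involutive A ⟨
  ∁ (∁ A)  ≡⟨ cong ∁ ∁A≡∁B ⟩
  ∁ (∁ B)  ≡⟨ ∁-involutive B ⟩
  B        ∎
  where open ≡-Reasoning

IntersectionClosed : List (Subset n) → Set
IntersectionClosed 𝒰 = ∀ X Y → X ∈𝓕 𝒰 → Y ∈𝓕 𝒰 → (X ∩ Y) ∈𝓕 𝒰

∁-unionClosed : IntersectionClosed 𝒰 → UnionClosed (map ∁ 𝒰)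
∁-unionClosed {𝒰 = 𝒰} ∩-closed _ _ X∈ Y∈ with ∈-map⁻ ∁ X∈ | ∈-map⁻ ∁ Y∈
... | A , A∈ , refl | B , B∈ , refl =
  subst (_∈𝓕 map ∁ 𝒰) (∁-∩ A B) (∈-map⁺ ∁ (∩-closed A B A∈ B∈))

⊆-⋃ : ∀ {ys} → X ∈ₗ ys → X ⊆ ⋃ ys
⊆-⋃ {ys = _ ∷ ys} (here refl) = p⊆p∪q (⋃ ys)
⊆-⋃ {ys = Y ∷ ys} (there X∈) x∈ = q⊆p∪q Y (⋃ ys) (⊆-⋃ X∈ x∈)

⋃-least : ∀ ys → (∀ {Y} → Y ∈ₗ ys → Y ⊆ C) → ⋃ ys ⊆ C
⋃-least [] _ x∈ = ⊥-elim (∉⊥ x∈)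
⋃-least (Y ∷ ys) ys⊆C x∈ with x∈p∪q⁻ Y (⋃ ys) x∈
... | inj₁ x∈Y = ys⊆C (here refl) x∈Y
... | inj₂ x∈⋃ = ⋃-least ys (ys⊆C ∘ there) x∈⋃

⋃-∈ : UnionClosed 𝒳 → ⊥ ∈𝓕 𝒳 → ∀ ys → (∀ {Y} → Y ∈ₗ ys → Y ∈𝓕 𝒳) → ⋃ ys ∈𝓕 𝒳
⋃-∈ uc ⊥∈ [] _ = ⊥∈
⋃-∈ uc ⊥∈ (Y ∷ ys) ys⊆𝒳 = uc Y (⋃ ys) (ys⊆𝒳 (here refl)) (⋃-∈ uc ⊥∈ ys (ys⊆𝒳 ∘ there))

∷⊥-unionClosed : UnionClosed 𝒳 → UnionClosed (⊥ ∷ 𝒳)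
∷⊥-unionClosed uc _ _ (here refl) (here refl) = here (∪-identityˡ ⊥)
∷⊥-unionClosed uc _ Y (here refl) (there Y∈) = there (subst (_∈𝓕 _) (sym (∪-identityˡ Y)) Y∈)
∷⊥-unionClosed uc X _ (there X∈) (here refl) = there (subst (_∈𝓕 _) (sym (∪-identityʳ X)) X∈)
∷⊥-unionClosed uc X Y (there X∈) (there Y∈) = there (uc X Y X∈ Y∈)

nonemptyMember : X ∈𝓕 𝒳 → ¬ IsSingletonEmpty 𝒳 → ∃ λ Y → Y ∈𝓕 𝒳 × Nonempty Y
nonemptyMember {𝒳 = 𝒳} X∈ nontrivial with any? nonempty? 𝒳
... | yes ∃Y = find ∃Y
... | no ∄Y = ⊥-elim (nontrivial λ Y → mk⇔ allEmpty λ { refl → subst (_∈𝓕 𝒳) (allEmpty X∈) X∈ })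
  where
  allEmpty : ∀ {Y} → Y ∈𝓕 𝒳 → Y ≡ ⊥
  allEmpty Y∈ = Empty-unique (All.lookup (¬Any⇒All¬ 𝒳 ∄Y) Y∈)

length-filter-map : ∀ {A B : Set} {P : B → Set} (P? : Decidable P) (f : A → B) xs →
                    length (filter P? (map f xs)) ≡ length (filter (P? ∘ f) xs)
length-filter-map P? f [] = refl
length-filter-map P? f (x ∷ xs) with P? (f x)
... | yes _ = cong suc (length-filter-map P? f xs)
... | no _ = length-filter-map P? f xs

member-of-filter : ∀ {A : Set} {P : A → Set} (P? : Decidable P) xs →
                   0 < length (filter P? xs) → ∃ λ x → x ∈ₗ xs × P x
member-of-filter P? xs 0<len with filter P? xs in eq
... | [] = contradiction 0<len n≮0
... | y ∷ _ = y , ∈-filter⁻ P? (subst (y ∈ₗ_) (sym eq) (here refl))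

countContaining-∁ : ∀ (x : Fin n) 𝒳 →
                    countContaining x 𝒳 + countContaining x (map ∁ 𝒳) ≡ length 𝒳
countContaining-∁ x [] = refl
countContaining-∁ x (X ∷ 𝒳) with x ∈? X | x ∈? ∁ X
... | yes x∈X | yes x∈∁X = contradiction x∈X (x∈∁p⇒x∉p x∈∁X)
... | yes _   | no _     = cong suc (countContaining-∁ x 𝒳)
... | no _    | yes _    = trans (+-suc _ _) (cong suc (countContaining-∁ x 𝒳))
... | no x∉X  | no x∉∁X  = contradiction (x∉p⇒x∈∁p x∉X) x∉∁X

countContaining-∷⊥ : ∀ (x : Fin n) 𝒳 → countContaining x (⊥ ∷ 𝒳) ≡ countContaining x 𝒳
countContaining-∷⊥ x 𝒳 with x ∈? ⊥
... | yes x∈⊥ = contradiction x∈⊥ ∉⊥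
... | no _ = refl

half-complement : ∀ a b {m} → a + b ≡ m → (m ≤ 2 * a ⇔ 2 * b ≤ m)
half-complement a b refl rewrite +-identityʳ a | +-identityʳ b =
  mk⇔ (λ le → +-monoˡ-≤ b (+-cancelˡ-≤ a b a le))
      (λ le → +-monoʳ-≤ a (+-cancelʳ-≤ b b a le))

Abundant : Fin n → List (Subset n) → Set
Abundant x 𝒳 = length 𝒳 ≤ 2 * countContaining x 𝒳

Rare : Fin n → List (Subset n) → Set
Rare x 𝒳 = 2 * countContaining x 𝒳 ≤ length 𝒳

abundant-in-∁⇒rare : ∀ {x : Fin n} 𝒰 → Abundant x (map ∁ 𝒰) → Rare x 𝒰
abundant-in-∁⇒rare {x = x} 𝒰 abundant =
  Equivalence.to
    (half-complement (countContaining x (map ∁ 𝒰)) (countContaining x 𝒰)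
                     (trans (+-comm (countContaining x (map ∁ 𝒰)) _) (countContaining-∁ x 𝒰)))
    (subst (_≤ 2 * countContaining x (map ∁ 𝒰)) (length-map ∁ 𝒰) abundant)

rare-in-∁⇒abundant : ∀ {x : Fin n} 𝒳 → Rare x (map ∁ 𝒳) → Abundant x 𝒳
rare-in-∁⇒abundant {x = x} 𝒳 rare =
  Equivalence.from
    (half-complement (countContaining x 𝒳) (countContaining x (map ∁ 𝒳)) (countContaining-∁ x 𝒳))
    (subst (2 * countContaining x (map ∁ 𝒳) ≤_) (length-map ∁ 𝒳) rare)

abundant-∷⊥ : ∀ {x : Fin n} 𝒳 → Abundant x (⊥ ∷ 𝒳) → Abundant x 𝒳
abundant-∷⊥ {x = x} 𝒳 abundant =
  ≤-trans (n≤1+n _) (subst (λ c → suc (length 𝒳) ≤ 2 * c) (countContaining-∷⊥ x 𝒳) abundant)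

abundant⇒∈⋃ : ∀ {x : Fin n} → X ∈𝓕 𝒳 → Abundant x 𝒳 → ∃ λ Y → Y ∈𝓕 𝒳 × x ∈ Y
abundant⇒∈⋃ {𝒳 = 𝒳} {x} X∈ abundant =
  member-of-filter (x ∈?_) 𝒳 (*-cancelˡ-< 2 0 _ (<-≤-trans (∈-length X∈) abundant))

-- Maximal stable sets of a bipartite graph

NoEdgeFrom : (Fin p → Fin q → Bool) → Subset p → Fin q → Set
NoEdgeFrom E A w = ∀ u → u ∈ A → E u w ≢ true

noEdgeFrom? : ∀ (E : Fin p → Fin q → Bool) A → Decidable (NoEdgeFrom E A)
noEdgeFrom? E A w = all? λ u → u ∈? A →-dec ¬? (E u w ≟ᵇ true)

nonNeighbours : (Fin p → Fin q → Bool) → Subset p → Subset q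
nonNeighbours E A = subset (noEdgeFrom? E A)

closure : (Fin p → Fin q → Bool) → Subset p → VSet p q
closure E A = nonNeighbours (flip E) (nonNeighbours E A) , nonNeighbours E A

Closed : (Fin p → Fin q → Bool) → Subset p → Set
Closed E A = proj₁ (closure E A) ⊆ A

Stable-transpose : ∀ {E : Fin p → Fin q → Bool} {S} → Stable E S → Stable (flip E) (swap S)
Stable-transpose stable w u w∈ u∈ = stable u w u∈ w∈

MaximalStable-transpose : ∀ {E : Fin p → Fin q → Bool} {S} →
                          MaximalStable E S → MaximalStable (flip E) (swap S)
MaximalStable-transpose (stable , maximal) =
  Stable-transpose stable ,
  λ T stableT (S₁⊆ , S₂⊆) → cong swap (maximal (swap T) (Stable-transpose stableT) (S₂⊆ , S₁⊆))

module _ (E : Fin p → Fin q → Bool) where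

  ∈-nonNeighbours⁺ : ∀ {w} → NoEdgeFrom E A w → w ∈ nonNeighbours E A
  ∈-nonNeighbours⁺ {A = A} = ∈-subset⁺ (noEdgeFrom? E A)

  ∈-nonNeighbours⁻ : ∀ {w} → w ∈ nonNeighbours E A → NoEdgeFrom E A w
  ∈-nonNeighbours⁻ {A = A} = ∈-subset⁻ (noEdgeFrom? E A)

  Stable⇒⊆nonNeighbours : ∀ {B} → Stable E (A , B) → B ⊆ nonNeighbours E A
  Stable⇒⊆nonNeighbours stable w∈ = ∈-nonNeighbours⁺ λ u u∈ → stable u _ u∈ w∈

  ⊆nonNeighbours⇒Stable : ∀ {B} → B ⊆ nonNeighbours E A → Stable E (A , B)
  ⊆nonNeighbours⇒Stable B⊆ u w u∈ w∈ = ∈-nonNeighbours⁻ (B⊆ w∈) u u∈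

  nonNeighbours-antitone : A ⊆ B → nonNeighbours E B ⊆ nonNeighbours E A
  nonNeighbours-antitone A⊆B w∈ = ∈-nonNeighbours⁺ λ u u∈ → ∈-nonNeighbours⁻ w∈ u (A⊆B u∈)

module _ (E : Fin p → Fin q → Bool) where

  ⊆-closure : A ⊆ proj₁ (closure E A)
  ⊆-closure = Stable⇒⊆nonNeighbours (flip E) (Stable-transpose (⊆nonNeighbours⇒Stable E ⊆-refl))

  closure-monotone : A ⊆ B → proj₁ (closure E A) ⊆ proj₁ (closure E B)
  closure-monotone = nonNeighbours-antitone (flip E) ∘ nonNeighbours-antitone E

  closure-stable : Stable E (closure E A)
  closure-stable = Stable-transpose (⊆nonNeighbours⇒Stable (flip E) ⊆-refl)

  closure-maximal : ∀ A → MaximalStable E (closure E A)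
  closure-maximal A = closure-stable , λ (T₁ , T₂) stableT (⊆T₁ , ⊆T₂) →
    let T₁⊆ : T₁ ⊆ proj₁ (closure E A)
        T₁⊆ x∈ = nonNeighbours-antitone (flip E) ⊆T₂
                   (Stable⇒⊆nonNeighbours (flip E) (Stable-transpose stableT) x∈)
        T₂⊆ : T₂ ⊆ nonNeighbours E A
        T₂⊆ x∈ = nonNeighbours-antitone E ⊆-closure
                   (nonNeighbours-antitone E ⊆T₁ (Stable⇒⊆nonNeighbours E stableT x∈))
    in cong₂ _,_ (⊆-antisym T₁⊆ ⊆T₁) (⊆-antisym T₂⊆ ⊆T₂)

  maximal⇒≡closure : ∀ {S} → MaximalStable E S → S ≡ closure E (proj₁ S)
  maximal⇒≡closure (stable , maximal) =
    sym (maximal _ closure-stable (⊆-closure , Stable⇒⊆nonNeighbours E stable))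

  maximal⇒Closed : ∀ {S} → MaximalStable E S → Closed E (proj₁ S)
  maximal⇒Closed m = ⊆-reflexive (cong proj₁ (sym (maximal⇒≡closure m)))

  Closed-∩ : Closed E A → Closed E B → Closed E (A ∩ B)
  Closed-∩ {A = A} {B = B} A-closed B-closed x∈ =
    x∈p∩q⁺ ( A-closed (closure-monotone (p∩q⊆p A B) x∈)
           , B-closed (closure-monotone (p∩q⊆q A B) x∈))

  Closed⇒trace-closure : Closed E A → proj₁ (closure E A) ≡ A
  Closed⇒trace-closure A-closed = ⊆-antisym A-closed ⊆-closure

traces : List (VSet p q) → List (Subset p)
traces = map proj₁

rareU⇔rare-traces : ∀ {u : Fin p} (L : List (VSet p q)) →
                    2 * countU u L ≤ length L ⇔ Rare u (traces L)
rareU⇔rare-traces {u = u} L =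
  subst₂ (λ c m → (2 * countU u L ≤ length L) ⇔ (2 * c ≤ m))
         (sym (length-filter-map (u ∈?_) proj₁ L)) (sym (length-map proj₁ L)) (⇔-id _)

countW≡countU-swap : ∀ (w : Fin q) (L : List (VSet p q)) → countW w L ≡ countU w (map swap L)
countW≡countU-swap w L = sym (length-filter-map (λ S → w ∈? proj₁ S) swap L)

Enumerates : (Fin p → Fin q → Bool) → List (VSet p q) → Set
Enumerates E L = ∀ S → (S ∈ₗ L ⇔ MaximalStable E S)

module Traces {E : Fin p → Fin q → Bool} {L} (enum : Enumerates E L) where

  maximal : ∀ {S} → S ∈ₗ L → MaximalStable E S
  maximal {S} = Equivalence.to (enum S)

  maximal⇒∈ : ∀ {S} → MaximalStable E S → S ∈ₗ L
  maximal⇒∈ {S} = Equivalence.from (enum S)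

  ≡map-closure-traces : L ≡ map (closure E) (traces L)
  ≡map-closure-traces = begin
    L                          ≡⟨ map-id L ⟨
    map id L                   ≡⟨ map-cong-local (All.tabulate (maximal⇒≡closure E ∘ maximal)) ⟩
    map (closure E ∘ proj₁) L  ≡⟨ map-∘ L ⟩
    map (closure E) (traces L) ∎
    where open ≡-Reasoning

  traces-unique : Unique L → Unique (traces L)
  traces-unique unique = Unique.map⁻ (subst Unique ≡map-closure-traces unique)

  traces-∩-closed : IntersectionClosed (traces L)
  traces-∩-closed _ _ A∈ B∈ with ∈-map⁻ proj₁ A∈ | ∈-map⁻ proj₁ B∈
  ... | S , S∈ , refl | T , T∈ , refl =
    subst (_∈𝓕 traces L)
          (Closed⇒trace-closure E (Closed-∩ E (maximal⇒Closed E (maximal S∈))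
                                              (maximal⇒Closed E (maximal T∈))))
          (∈-map⁺ proj₁ (maximal⇒∈ (closure-maximal E _)))

  edge⇒∁traces-nontrivial : HasEdge E →
    ∃ λ X → X ∈𝓕 map ∁ (traces L) × ¬ IsSingletonEmpty (map ∁ (traces L))
  edge⇒∁traces-nontrivial (u , w , uw) = ∁ (proj₁ S) , ∁S∈ , λ singleton∅ →
    ∉⊥ (subst (u ∈_) (Equivalence.to (singleton∅ _) ∁S∈) u∈∁S)
    where
    -- a maximal stable set containing w, which therefore misses u
    S : VSet p q
    S = swap (closure (flip E) ⁅ w ⁆)
    S-maximal : MaximalStable E S
    S-maximal = MaximalStable-transpose (closure-maximal (flip E) ⁅ w ⁆)
    ∁S∈ : ∁ (proj₁ S) ∈𝓕 map ∁ (traces L)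
    ∁S∈ = ∈-map⁺ ∁ (∈-map⁺ proj₁ (maximal⇒∈ S-maximal))
    u∈∁S : u ∈ ∁ (proj₁ S)
    u∈∁S = x∉p⇒x∈∁p λ u∈S → proj₁ S-maximal u w u∈S (⊆-closure (flip E) (x∈⁅x⁆ w)) uw

transpose-enumerates : ∀ {E : Fin p → Fin q → Bool} {L} →
                       Enumerates E L → Enumerates (flip E) (map swap L)
transpose-enumerates {E = E} enum S = mk⇔
  (λ S∈ → let T , T∈ , S≡ = ∈-map⁻ swap S∈ in
          subst (MaximalStable (flip E)) (sym S≡) (MaximalStable-transpose (Traces.maximal enum T∈)))
  (∈-map⁺ swap ∘ Traces.maximal⇒∈ enum ∘ MaximalStable-transpose)

-- From union-closed families to bipartite graphs

unionClosed⇒rareU : UnionClosedConjecture →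
  ∀ {E : Fin p → Fin q → Bool} {L} → HasEdge E → Unique L → Enumerates E L →
  ∃ λ u → 2 * countU u L ≤ length L
unionClosed⇒rareU ucc {L = L} edge unique enum =
  let X , X∈ , nontrivial = edge⇒∁traces-nontrivial edge
      u , _ , abundant = ucc _ (map ∁ (traces L))
                             (Unique.map⁺ ∁-injective (traces-unique unique))
                             (∁-unionClosed traces-∩-closed) (X , X∈) nontrivial
  in u , Equivalence.from (rareU⇔rare-traces L) (abundant-in-∁⇒rare (traces L) abundant)
  where open Traces enum

unionClosed⇒bipartite : UnionClosedConjecture → BipartiteStatement
unionClosed⇒bipartite ucc p q E (u , w , uw) L unique enum =
  unionClosed⇒rareU ucc (u , w , uw) unique enum ,
  (let w′ , rare = unionClosed⇒rareU ucc (w , u , uw) (Unique.map⁺ (cong swap) unique)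
                                     (transpose-enumerates enum)
   in w′ , subst₂ (λ c m → 2 * c ≤ m) (sym (countW≡countU-swap w′ L)) (length-map swap L) rare)

-- From bipartite graphs to union-closed families

module Incidence {n} (𝒳 : List (Subset n)) where

  incidence : Fin n → Fin (length 𝒳) → Bool
  incidence u w = does (u ∈? lookup 𝒳 w)

  ∈⇒adjacent : ∀ {u w} → u ∈ lookup 𝒳 w → incidence u w ≡ true
  ∈⇒adjacent {u} = dec-true (u ∈? _)

  adjacent⇒∈ : ∀ {u w} → incidence u w ≡ true → u ∈ lookup 𝒳 w
  adjacent⇒∈ {u} = does≡true⇒ (u ∈? _)

  incidence-edge : X ∈𝓕 𝒳 → Nonempty X → HasEdge incidence
  incidence-edge X∈ (x , x∈X) = x , index X∈ , ∈⇒adjacent (subst (x ∈_) (lookup-index X∈) x∈X)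

  ∁-Closed : X ∈𝓕 𝒳 → Closed incidence (∁ X)
  ∁-Closed {X = X} X∈ {u} u∈ = x∉p⇒x∈∁p λ u∈X →
    ∈-nonNeighbours⁻ (flip incidence) u∈ w w∈ (∈⇒adjacent (subst (u ∈_) X≡ u∈X))
    where
    w : Fin (length 𝒳)
    w = index X∈
    X≡ : X ≡ lookup 𝒳 w
    X≡ = lookup-index X∈
    w∈ : w ∈ nonNeighbours incidence (∁ X)
    w∈ = ∈-nonNeighbours⁺ incidence λ v v∈∁X vw →
      x∈∁p⇒x∉p v∈∁X (subst (v ∈_) (sym X≡) (adjacent⇒∈ vw))

  maximalStableSets : List (VSet n (length 𝒳))
  maximalStableSets = map (closure incidence ∘ ∁) 𝒳

  traces-maximalStableSets : traces maximalStableSets ≡ map ∁ 𝒳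
  traces-maximalStableSets = trans (sym (map-∘ 𝒳))
    (map-cong-local (All.tabulate λ X∈ → Closed⇒trace-closure incidence (∁-Closed X∈)))

  maximalStableSets-unique : Unique 𝒳 → Unique maximalStableSets
  maximalStableSets-unique unique =
    Unique.map⁻ (subst Unique (sym traces-maximalStableSets) (Unique.map⁺ ∁-injective unique))

  module _ (uc : UnionClosed 𝒳) (⊥∈ : ⊥ ∈𝓕 𝒳) where

    -- ∁ S₁ is the union of the members of 𝒳 disjoint from S₁.
    maximal⇒∁trace∈ : ∀ {S} → MaximalStable incidence S → ∁ (proj₁ S) ∈𝓕 𝒳
    maximal⇒∁trace∈ {S₁ , _} m =
      subst (_∈𝓕 𝒳) (sym ∁S₁≡⋃) (⋃-∈ uc ⊥∈ disjoint λ Y∈ → proj₁ (∈-filter⁻ (_⊆? ∁ S₁) Y∈))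
      where
      disjoint : List (Subset n)
      disjoint = filter (_⊆? ∁ S₁) 𝒳
      ∁⋃⊆S₁ : ∁ (⋃ disjoint) ⊆ S₁
      ∁⋃⊆S₁ {u} u∈ = maximal⇒Closed incidence m
        (∈-nonNeighbours⁺ (flip incidence) λ w w∈ uw →
          x∈∁p⇒x∉p u∈ (⊆-⋃ (∈-filter⁺ (_⊆? ∁ S₁) (∈-lookup {xs = 𝒳} w) (member⊆ w∈)) (adjacent⇒∈ uw)))
        where
        member⊆ : ∀ {w} → w ∈ nonNeighbours incidence S₁ → lookup 𝒳 w ⊆ ∁ S₁
        member⊆ w∈ v∈ = x∉p⇒x∈∁p λ v∈S₁ → ∈-nonNeighbours⁻ incidence w∈ _ v∈S₁ (∈⇒adjacent v∈)
      ∁S₁≡⋃ : ∁ S₁ ≡ ⋃ disjoint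
      ∁S₁≡⋃ = ⊆-antisym (λ u∈ → x∉∁p⇒x∈p λ u∈∁⋃ → x∈∁p⇒x∉p u∈ (∁⋃⊆S₁ u∈∁⋃))
                        (⋃-least disjoint λ Y∈ → proj₂ (∈-filter⁻ (_⊆? ∁ S₁) {xs = 𝒳} Y∈))

    enumerates : Enumerates incidence maximalStableSets
    enumerates S = mk⇔
      (λ S∈ → let X , _ , S≡ = ∈-map⁻ (closure incidence ∘ ∁) S∈ in
              subst (MaximalStable incidence) (sym S≡) (closure-maximal incidence (∁ X)))
      (λ m → subst (_∈ₗ maximalStableSets)
                   (sym (trans (maximal⇒≡closure incidence m)
                               (cong (closure incidence) (sym (∁-involutive _)))))
                   (∈-map⁺ (closure incidence ∘ ∁) (maximal⇒∁trace∈ m)))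

bipartite⇒abundant-∋⊥ : ∀ {n} {𝒳 : List (Subset n)} {X} → BipartiteStatement →
  UnionClosed 𝒳 → Unique 𝒳 → ⊥ ∈𝓕 𝒳 → X ∈𝓕 𝒳 → Nonempty X → ∃ λ x → Abundant x 𝒳
bipartite⇒abundant-∋⊥ {n} {𝒳} bip uc unique ⊥∈ X∈ X≠∅ =
  let u , rare = proj₁ (bip n (length 𝒳) incidence (incidence-edge X∈ X≠∅) maximalStableSets
                            (maximalStableSets-unique unique) (enumerates uc ⊥∈))
  in u , rare-in-∁⇒abundant 𝒳
           (subst (Rare u) traces-maximalStableSets
                  (Equivalence.to (rareU⇔rare-traces maximalStableSets) rare))
  where open Incidence 𝒳

bipartite⇒abundant : BipartiteStatement →
  UnionClosed 𝒳 → Unique 𝒳 → X ∈𝓕 𝒳 → Nonempty X → ∃ λ x → Abundant x 𝒳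
bipartite⇒abundant {𝒳 = 𝒳} bip uc unique X∈ X≠∅ with any? (≡-dec _≟ᵇ_ ⊥) 𝒳
... | yes ⊥∈ = bipartite⇒abundant-∋⊥ bip uc unique ⊥∈ X∈ X≠∅
... | no ⊥∉ =
  let x , abundant = bipartite⇒abundant-∋⊥ bip (∷⊥-unionClosed uc) (¬Any⇒All¬ 𝒳 ⊥∉ ∷ unique)
                                           (here refl) (there X∈) X≠∅
  in x , abundant-∷⊥ 𝒳 abundant

bipartite⇒unionClosed : BipartiteStatement → UnionClosedConjecture
bipartite⇒unionClosed bip n 𝒳 unique uc (X , X∈) nontrivial =
  let Y , Y∈ , Y≠∅ = nonemptyMember X∈ nontrivial
      x , abundant = bipartite⇒abundant bip uc unique Y∈ Y≠∅
  in x , abundant⇒∈⋃ X∈ abundant , abundant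

theorem5 : UnionClosedConjecture ⇔ BipartiteStatement
theorem5 = mk⇔ unionClosed⇒bipartite bipartite⇒unionClosed
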